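{- Let $P=\nu X.\prod_{i\in I}A_i$ be a $\mathcal T$-compatible annotated normal form. Then for every path in the forest $\Phi_{\mathcal T}(P)$ whose successive labels are $(x_1,t_1),\dots,(x_k,t_k),A_j$ (each node the parent of the next, the last node labelled by the sequential term $A_j$, $j\in I$), every $x_i$ ($1\le i\le k$) is tied to $A_j$ in $P$.
   Context: $\pi$-terms: $P ::= \nu x.P \mid P_1\parallel P_2 \mid M \mid\, !M$, $M ::= \mathbf 0 \mid M+M \mid \pi.P$, $\pi ::= a(x)\mid \overline a\langle b\rangle \mid \tau$; $M$, $!M$ sequential; $\mathrm{fn}$ free names. Structural congruence $\equiv$: smallest congruence containing $\alpha$-conversion, commutativity/associativity of $+$, $\parallel$ with neutral $\mathbf 0$, $\nu x.\mathbf 0\equiv\mathbf 0$, $\nu x.\nu y.P\equiv\nu y.\nu x.P$, $!\mathbf 0\equiv\mathbf 0$, $!M\equiv M\parallel!M$, $P\parallel\nu a.Q\equiv\nu a.(P\parallel Q)$ if $a\notin\mathrm{fn}(P)$. $(\mathcal T,\lessdot)$ a finite forest of base types, $<$ transitive closure of parent relation. Types $\tau::=t\mid t[\tau]$, $\mathrm{base}(t)=\mathrm{base}(t[\tau])=t$; annotated terms have restrictions $\nu(x{:}\tau)$. Normal forms $\nu X.\prod_{i\in I}A_i$: $X$ set of restrictions, each $A_i$ being $\sum_j\pi_j.N_j$ or $!(\sum_j\pi_j.N_j)$ with $N_j$ normal forms, each name bound at most once, free and bound names disjoint. $\mathrm{forest}(\nu(x{:}\tau).Q)$ is a root labelled $(x,\mathrm{base}(\tau))$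 with the roots of $\mathrm{forest}(Q)$ as children; $\mathrm{forest}(Q_1\parallel Q_2)$ disjoint union; sequential $Q$ gives a single node labelled $Q$; $\mathrm{forest}(\mathbf 0)$ empty. A forest is $\mathcal T$-compatible if along every path $n_1\cdots n_kn$ (parent to child) with $n$ labelled by a sequential term and $n_i$ labelled $(x_i,t_i)$, $t_1<\cdots<t_k$; a term $P$ is $\mathcal T$-compatible if $\mathrm{forest}(Q)$ is $\mathcal T$-compatible for some $Q\equiv P$. For $P=\nu X.\prod_{i\in I}A_i$: $i$ linked to $j$ if $\mathrm{fn}(A_i)\cap\mathrm{fn}(A_j)$ contains a name restricted in $X$; tied-to is the transitive closure of linked-to; a name $y$ is tied to $A_i$ in $P$ if $y\in\mathrm{fn}(A_j)$ for some $j$ tied to $i$. $\Phi_{\mathcal T}$: with $\min_{\mathcal T}(X)=\{(x{:}\tau)\in X\mid\forall(y{:}\tau')\in X,\ \mathrm{base}(\tau')\not<\mathrm{base}(\tau)\}$, $l[\phi]$ a new root labelled $l$ above the roots of $\phi$, and $\uplus$ disjoint union: if $X=\emptyset$, $\Phi_{\mathcal T}(P)=\biguplus_{i\in I}A_i[\,]$; else $\Phi_{\mathcal T}(P)=\big(\biguplus_{(x:\tau)\in\min_{\mathcal T}(X)}(x,\mathrm{base}(\tau))[\Phi_{\mathcal T}(\nu Y_x.\prod_{j\in I_x}A_j)]\big)\uplus\Phi_{\mathcal T}(\nu Z.\prod_{r\in R}A_r)$ with $I_x=\{i\mid x\text{ tied to }A_i\text{ in }P\}$, $R=I\setminus\bigcup_xI_x$,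 $Y_x=\{(y{:}\tau)\in X\mid\exists i\in I_x,\ y\in\mathrm{fn}(A_i)\}\setminus\min_{\mathcal T}(X)$, $Z=X\setminus\bigcup_{(x:\tau)\in\min_{\mathcal T}(X)}(Y_x\cup\{x{:}\tau\})$. -}

module Defs where

open import Data.Nat using (ℕ; _≟_)
open import Data.Fin using (Fin)
open import Data.Maybe using (Maybe; just)
open import Data.List using (List; []; _∷_; _++_; map; filter; foldr; [_]; lookup; length; allFin)
open import Data.List.Membership.Propositional using (_∈_; _∉_)
open import Data.List.Relation.Unary.All using (All)
open import Data.List.Relation.Unary.Linked using (Linked)
open import Data.List.Relation.Unary.Unique.Propositional using (Unique)
open import Data.List.Relation.Binary.Disjoint.Propositional using (Disjoint)
open import Data.Product using (Σ; ∃; _×_; _,_; proj₁; proj₂)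
open import Data.Sum using (_⊎_)
open import Relation.Nullary using (¬_; yes; no; ¬?)
open import Relation.Binary.PropositionalEquality using (_≡_)
open import Relation.Binary.Construct.Closure.Transitive using (TransClosure)
open import Function.Bundles using (_⇔_)

Name : Set
Name = ℕ

-- transposition of two names (used to express α-conversion, nominal style)
swapN : Name → Name → Name → Name
swapN x y z with z ≟ x | z ≟ y
... | yes _ | _     = y
... | no _  | yes _ = x
... | no _  | no _  = z

_∖_ : List Name → Name → List Name
xs ∖ x = filter (λ y → ¬? (y ≟ x)) xs

record BaseForest : Set where
  field
    size   : ℕ
    parent : Fin size → Maybe (Fin size)

  _⋖_ : Fin size → Fin size → Set
  s ⋖ t = parent t ≡ just s

  _<_ : Fin size → Fin size → Set
  _<_ = TransClosure _⋖_

  field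
    acyclic : ∀ t → ¬ (t < t)

data Prefix : Set where
  inp : Name → Name → Prefix
  out : Name → Name → Prefix
  tau : Prefix

module _ (T : BaseForest) where
  open BaseForest T

  BaseTy : Set
  BaseTy = Fin size

  data Ty : Set where
    bty : BaseTy → Ty
    app : BaseTy → Ty → Ty

  baseOf : Ty → BaseTy
  baseOf (bty t)   = t
  baseOf (app t _) = t

  data Proc : Set
  data Sum : Set

  data Proc where
    ν    : Name → Ty → Proc → Proc
    _∥_  : Proc → Proc → Proc
    sq   : Sum → Proc
    bang : Sum → Proc

  data Sum where
    nil : Sum
    _⊕_ : Sum → Sum → Sum
    pre : Prefix → Proc → Sum

  𝟘 : Proc
  𝟘 = sq nil

  fnP : Proc → List Name
  fnM : Sum → List Name
  fnπ : Prefix → Proc → List Name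
  fnP (ν x τ P)  = fnP P ∖ x
  fnP (P ∥ Q)    = fnP P ++ fnP Q
  fnP (sq M)     = fnM M
  fnP (bang M)   = fnM M
  fnM nil        = []
  fnM (M ⊕ N)    = fnM M ++ fnM N
  fnM (pre π P)  = fnπ π P
  fnπ (inp a x) P = a ∷ (fnP P ∖ x)
  fnπ (out a b) P = a ∷ b ∷ fnP P
  fnπ tau P       = fnP P

  -- bound names (with multiplicity: one entry per binder)
  bnP : Proc → List Name
  bnM : Sum → List Name
  bnπ : Prefix → List Name
  bnP (ν x τ P)  = x ∷ bnP P
  bnP (P ∥ Q)    = bnP P ++ bnP Q
  bnP (sq M)     = bnM M
  bnP (bang M)   = bnM M
  bnM nil        = []
  bnM (M ⊕ N)    = bnM M ++ bnM N
  bnM (pre π P)  = bnπ π ++ bnP P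
  bnπ (inp a x)  = [ x ]
  bnπ (out a b)  = []
  bnπ tau        = []

  swapπ : Name → Name → Prefix → Prefix
  swapπ x y (inp a z) = inp (swapN x y a) (swapN x y z)
  swapπ x y (out a b) = out (swapN x y a) (swapN x y b)
  swapπ x y tau       = tau

  swapP : Name → Name → Proc → Proc
  swapM : Name → Name → Sum → Sum
  swapP x y (ν z τ P) = ν (swapN x y z) τ (swapP x y P)
  swapP x y (P ∥ Q)   = swapP x y P ∥ swapP x y Q
  swapP x y (sq M)    = sq (swapM x y M)
  swapP x y (bang M)  = bang (swapM x y M)
  swapM x y nil       = nil
  swapM x y (M ⊕ N)   = swapM x y M ⊕ swapM x y N
  swapM x y (pre π P) = pre (swapπ x y π) (swapP x y P)

  data _≈P_ : Proc → Proc → Set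
  data _≈M_ : Sum → Sum → Set

  data _≈P_ where
    reflP   : ∀ {P} → P ≈P P
    symP    : ∀ {P Q} → P ≈P Q → Q ≈P P
    transP  : ∀ {P Q R} → P ≈P Q → Q ≈P R → P ≈P R
    ν-cong  : ∀ {x τ P Q} → P ≈P Q → ν x τ P ≈P ν x τ Q
    ∥-cong  : ∀ {P P′ Q Q′} → P ≈P P′ → Q ≈P Q′ → (P ∥ Q) ≈P (P′ ∥ Q′)
    sq-cong : ∀ {M N} → M ≈M N → sq M ≈P sq N
    !-cong  : ∀ {M N} → M ≈M N → bang M ≈P bang N
    α-ν     : ∀ {x y τ P} → y ∉ fnP (ν x τ P) → ν x τ P ≈P ν y τ (swapP x y P)
    ∥-comm  : ∀ {P Q} → (P ∥ Q) ≈P (Q ∥ P)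
    ∥-assoc : ∀ {P Q R} → ((P ∥ Q) ∥ R) ≈P (P ∥ (Q ∥ R))
    ∥-unit  : ∀ {P} → (P ∥ 𝟘) ≈P P
    ν-nil   : ∀ {x τ} → ν x τ 𝟘 ≈P 𝟘
    ν-swap  : ∀ {x σ y τ P} → ν x σ (ν y τ P) ≈P ν y τ (ν x σ P)
    !-nil   : bang nil ≈P 𝟘
    !-unf   : ∀ {M} → bang M ≈P (sq M ∥ bang M)
    extr    : ∀ {a τ P Q} → a ∉ fnP P → (P ∥ ν a τ Q) ≈P ν a τ (P ∥ Q)

  data _≈M_ where
    reflM    : ∀ {M} → M ≈M M
    symM     : ∀ {M N} → M ≈M N → N ≈M M
    transM   : ∀ {M N K} → M ≈M N → N ≈M K → M ≈M K
    ⊕-cong   : ∀ {M M′ N N′} → M ≈M M′ → N ≈M N′ → (M ⊕ N) ≈M (M′ ⊕ N′)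
    pre-cong : ∀ {π P Q} → P ≈P Q → pre π P ≈M pre π Q
    α-inp    : ∀ {a x y P} → y ∉ (fnP P ∖ x) → pre (inp a x) P ≈M pre (inp a y) (swapP x y P)
    ⊕-comm   : ∀ {M N} → (M ⊕ N) ≈M (N ⊕ M)
    ⊕-assoc  : ∀ {M N K} → ((M ⊕ N) ⊕ K) ≈M (M ⊕ (N ⊕ K))
    ⊕-unit   : ∀ {M} → (M ⊕ nil) ≈M M

  data Label (A : Set) : Set where
    res  : Name → BaseTy → Label A
    leaf : A → Label A

  resL : {A : Set} → Name × BaseTy → Label A
  resL (x , t) = res x t

  data Tree (A : Set) : Set where
    node : Label A → List (Tree A) → Tree A

  data DownPath {A : Set} : Tree A → List (Label A) → Set where
    here  : ∀ {l ts} → DownPath (node l ts) [ l ]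
    there : ∀ {l ts t ls} → t ∈ ts → DownPath t ls → DownPath (node l ts) (l ∷ ls)

  data PathIn {A : Set} : Tree A → List (Label A) → Set where
    top   : ∀ {t ls} → DownPath t ls → PathIn t ls
    below : ∀ {l ts t ls} → t ∈ ts → PathIn t ls → PathIn (node l ts) ls

  forest : Proc → List (Tree Proc)
  forest (ν x τ Q)       = [ node (res x (baseOf τ)) (forest Q) ]
  forest (P ∥ Q)         = forest P ++ forest Q
  forest (sq nil)        = []
  forest (sq (M ⊕ N))    = [ node (leaf (sq (M ⊕ N))) [] ]
  forest (sq (pre π P))  = [ node (leaf (sq (pre π P))) [] ]
  forest (bang M)        = [ node (leaf (bang M)) [] ]

  IsSeq : Proc → Set
  IsSeq P = (∃ λ M → P ≡ sq M) ⊎ (∃ λ M → P ≡ bang M)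

  CompatibleForest : List (Tree Proc) → Set
  CompatibleForest F =
    ∀ {tr} → tr ∈ F → (xs : List (Name × BaseTy)) (q : Proc) →
    PathIn tr (map resL xs ++ [ leaf q ]) → IsSeq q →
    Linked _<_ (map proj₂ xs)

  Compatible : Proc → Set
  Compatible P = ∃ λ Q → (Q ≈P P) × CompatibleForest (forest Q)

  -- annotated normal forms  ν X. ∏_{i∈I} A_i

  Res : Set
  Res = Name × Ty

  data NF : Set
  data SeqNF : Set

  data NF where
    nf : List Res → List SeqNF → NF

  data SeqNF where
    sumNF : List (Prefix × NF) → SeqNF
    repNF : List (Prefix × NF) → SeqNF

  restrict : List Res → Proc → Proc
  restrict X P = foldr (λ r Q → ν (proj₁ r) (proj₂ r) Q) P X

  nfProc   : NF → Proc
  seqProc  : SeqNF → Proc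
  parProc  : List SeqNF → Proc
  sumProc  : List (Prefix × NF) → Sum
  nfProc (nf X As)     = restrict X (parProc As)
  seqProc (sumNF ss)   = sq (sumProc ss)
  seqProc (repNF ss)   = bang (sumProc ss)
  parProc []           = 𝟘
  parProc (A ∷ As)     = seqProc A ∥ parProc As
  sumProc []           = nil
  sumProc ((π , N) ∷ ss) = pre π (nfProc N) ⊕ sumProc ss

  WellFormedNF : NF → Set
  WellFormedNF N = Unique (bnP (nfProc N)) × Disjoint (fnP (nfProc N)) (bnP (nfProc N))

  comp : (As : List SeqNF) → Fin (length As) → Proc
  comp As i = seqProc (lookup As i)

  -- linked / tied / Φ_𝒯 for ν X. ∏_{i∈J} A_i, components A : Fin m → Proc

  module _ {m : ℕ} (A : Fin m → Proc) where

    LinkedTo : List Res → List (Fin m) → Fin m → Fin m → Set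
    LinkedTo X J i j = i ∈ J × j ∈ J ×
      ∃ λ y → y ∈ fnP (A i) × y ∈ fnP (A j) × y ∈ map proj₁ X

    TiedTo : List Res → List (Fin m) → Fin m → Fin m → Set
    TiedTo X J = TransClosure (LinkedTo X J)

    TiedName : List Res → List (Fin m) → Name → Fin m → Set
    TiedName X J y i = ∃ λ j → TiedTo X J i j × y ∈ fnP (A j)

    MinT : List Res → Res → Set
    MinT X r = r ∈ X × (∀ {r′} → r′ ∈ X → ¬ (baseOf (proj₂ r′) < baseOf (proj₂ r)))

    record Entry : Set where
      constructor entry
      field
        ex  : Name
        eτ  : Ty
        eI  : List (Fin m)
        eY  : List Res
        eF  : List (Tree (Fin m))
    open Entry public

    -- Φ_𝒯 as the graph of the recursive definition; sets are represented
    -- by lists specified through their membership.  Leaves are labelled by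
    -- the index j of the component A_j.
    data PhiRel : List Res → List (Fin m) → List (Tree (Fin m)) → Set where
      Φ-empty : ∀ {J} → PhiRel [] J (map (λ j → node (leaf j) []) J)
      Φ-split : ∀ {r Xs J} → let X = r ∷ Xs in
        (ms : List Entry) (Z : List Res) (R : List (Fin m)) (FR : List (Tree (Fin m))) →
        (∀ r′ → (r′ ∈ map (λ e → (ex e , eτ e)) ms) ⇔ MinT X r′) →
        All (λ e →
              (∀ i → (i ∈ eI e) ⇔ (i ∈ J × TiedName X J (ex e) i))
            × (∀ r′ → (r′ ∈ eY e) ⇔
                 (r′ ∈ X × (∃ λ i → i ∈ eI e × proj₁ r′ ∈ fnP (A i)) × ¬ MinT X r′))
            × PhiRel (eY e) (eI e) (eF e)) ms →
        (∀ i → (i ∈ R) ⇔ (i ∈ J × All (λ e → i ∉ eI e) ms)) →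
        (∀ r′ → (r′ ∈ Z) ⇔ (r′ ∈ X × ¬ MinT X r′ × All (λ e → r′ ∉ eY e) ms)) →
        PhiRel Z R FR →
        PhiRel X J (map (λ e → node (res (ex e) (baseOf (eτ e))) (eF e)) ms ++ FR)

-- Φ_𝒯 places a node (x, t) only above the leaves of Φ_𝒯(ν Y_x. ∏_{I_x} A_j), and
-- those are components of I_x, all tied to x.  The recursive calls on
-- ν Y_x. ∏_{I_x} A_j and ν Z. ∏_R A_r have fewer restrictions and components than
-- P, so any tie they establish is also a tie in P.
module Submission where

open import Defs
open import Data.Nat using (ℕ)
open import Data.Fin using (Fin)
open import Data.List using (List; _∷_; _++_; map; [_]; length; allFin)
open import Data.List.Membership.Propositional using (_∈_; lose)
open import Data.List.Membership.Propositional.Properties using (∈-map⁺; ∈-++⁺ʳ)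
open import Data.List.Relation.Binary.Subset.Propositional using (_⊆_)
open import Data.List.Relation.Binary.Subset.Propositional.Properties using () renaming (map⁺ to ⊆-map⁺)
open import Data.List.Relation.Unary.Any using (Any; here; there; satisfied)
import Data.List.Relation.Unary.Any as Any
open import Data.List.Relation.Unary.Any.Properties using (map⁻; ++⁻)
open import Data.List.Relation.Unary.All using (All; _∷_)
open import Data.Product using (_×_; _,_; proj₁; proj₂; ∃)
open import Data.Sum using (inj₁; inj₂)
open import Relation.Nullary using (¬_)
open import Relation.Binary.PropositionalEquality using (refl)
open import Relation.Binary.Construct.Closure.Transitive using (TransClosure)
open import Function.Bundles using (Equivalence; _⇔_)
open Equivalence using (to)

TransClosure-map : ∀ {A : Set} {R S : A → A → Set} →
                   (∀ {a b} → R a b → S a b) →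
                   ∀ {a b} → TransClosure R a b → TransClosure S a b
TransClosure-map f TransClosure.[ r ]    = TransClosure.[ f r ]
TransClosure-map f (r TransClosure.∷ rs) = f r TransClosure.∷ TransClosure-map f rs

module _ {T : BaseForest} {A : Set} where

  infix 4 _∈ᵀ_

  data _∈ᵀ_ (l : Label T A) : Tree T A → Set where
    root  : ∀ {ts} → l ∈ᵀ node l ts
    child : ∀ {l′ ts} → Any (l ∈ᵀ_) ts → l ∈ᵀ node l′ ts

  data Above (l l′ : Label T A) : Tree T A → Set where
    root  : ∀ {ts} → Any (l′ ∈ᵀ_) ts → Above l l′ (node l ts)
    child : ∀ {l″ ts} → Any (Above l l′) ts → Above l l′ (node l″ ts)

  downPath⇒∈ᵀ : ∀ {tr ls l} → DownPath T tr ls → l ∈ ls → l ∈ᵀ tr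
  downPath⇒∈ᵀ here        (here refl) = root
  downPath⇒∈ᵀ (there _ _) (here refl) = root
  downPath⇒∈ᵀ (there c p) (there l∈)  = child (lose c (downPath⇒∈ᵀ p l∈))

  downPath⇒rootAbove : ∀ {tr l l′ ls} → DownPath T tr (l ∷ ls) → l′ ∈ ls → Above l l′ tr
  downPath⇒rootAbove (there c p) l′∈ = root (lose c (downPath⇒∈ᵀ p l′∈))

  downPath⇒above : ∀ {tr l l′ ls} → DownPath T tr (ls ++ [ l′ ]) → l ∈ ls → Above l l′ tr
  downPath⇒above {ls = _ ∷ ls}    p           (here refl) =
    downPath⇒rootAbove p (∈-++⁺ʳ ls (here refl))
  downPath⇒above {ls = _ ∷ _ ∷ _} (there c p) (there l∈)  =
    child (lose c (downPath⇒above p l∈))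

  pathIn⇒above : ∀ {tr l l′ ls} → PathIn T tr (ls ++ [ l′ ]) → l ∈ ls → Above l l′ tr
  pathIn⇒above (top p)     l∈ = downPath⇒above p l∈
  pathIn⇒above (below c p) l∈ = child (lose c (pathIn⇒above p l∈))

module _ (T : BaseForest) {m : ℕ} (A : Fin m → Proc T) where

  TiedName-mono : ∀ {X X′ J J′ y i} → X ⊆ X′ → J ⊆ J′ →
                  TiedName T A X J y i → TiedName T A X′ J′ y i
  TiedName-mono {X} {X′} {J} {J′} X⊆X′ J⊆J′ (k , i~k , y∈Ak) =
    k , TransClosure-map weaken i~k , y∈Ak
    where
      weaken : ∀ {a b} → LinkedTo T A X J a b → LinkedTo T A X′ J′ a b
      weaken (a∈J , b∈J , z , z∈Aa , z∈Ab , z∈X) =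
        J⊆J′ a∈J , J⊆J′ b∈J , z , z∈Aa , z∈Ab , ⊆-map⁺ proj₁ X⊆X′ z∈X

  EntrySpec : List (Res T) → List (Fin m) → Entry T A → Set
  EntrySpec X J e =
      (∀ i → (i ∈ eI e) ⇔ (i ∈ J × TiedName T A X J (ex e) i))
    × (∀ r′ → (r′ ∈ eY e) ⇔
         (r′ ∈ X × (∃ λ i → i ∈ eI e × proj₁ r′ ∈ fnP T (A i)) × ¬ MinT T A X r′))
    × PhiRel T A (eY e) (eI e) (eF e)

  entryTree : Entry T A → Tree T (Fin m)
  entryTree e = node (res (ex e) (baseOf T (eτ e))) (eF e)

  mutual
    PhiRel-leaves⊆ : ∀ {X J F j} → PhiRel T A X J F → Any (leaf j ∈ᵀ_) F → j ∈ J
    PhiRel-leaves⊆ Φ-empty o = Any.map (λ { root → refl }) (map⁻ o)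
    PhiRel-leaves⊆ (Φ-split ms _ _ _ _ specs R-spec _ φR) o with ++⁻ (map entryTree ms) o
    ... | inj₁ o′ = entries-leaves⊆ specs (map⁻ o′)
    ... | inj₂ o′ = proj₁ (to (R-spec _) (PhiRel-leaves⊆ φR o′))

    entries-leaves⊆ : ∀ {X J ms j} → All (EntrySpec X J) ms →
                      Any (λ e → leaf j ∈ᵀ entryTree e) ms → j ∈ J
    entries-leaves⊆ ((I-spec , _ , φ) ∷ _) (here (child o)) =
      proj₁ (to (I-spec _) (PhiRel-leaves⊆ φ o))
    entries-leaves⊆ (_ ∷ specs) (there o) = entries-leaves⊆ specs o

  mutual
    PhiRel-above⇒tied : ∀ {X J F x t j} → PhiRel T A X J F →
                        Any (Above (res x t) (leaf j)) F → TiedName T A X J x j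
    PhiRel-above⇒tied Φ-empty a with satisfied (map⁻ a)
    ... | _ , child ()
    PhiRel-above⇒tied (Φ-split ms Z R _ _ specs R-spec Z-spec φR) a with ++⁻ (map entryTree ms) a
    ... | inj₁ a′ = entries-above⇒tied specs (map⁻ a′)
    ... | inj₂ a′ = TiedName-mono (λ r∈Z → proj₁ (to (Z-spec _) r∈Z))
                                  (λ i∈R → proj₁ (to (R-spec _) i∈R))
                                  (PhiRel-above⇒tied φR a′)

    entries-above⇒tied : ∀ {X J ms x t j} → All (EntrySpec X J) ms →
                         Any (λ e → Above (res x t) (leaf j) (entryTree e)) ms →
                         TiedName T A X J x j
    entries-above⇒tied ((I-spec , _ , φ) ∷ _) (here (root o)) =
      proj₂ (to (I-spec _) (PhiRel-leaves⊆ φ o))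
    entries-above⇒tied ((I-spec , Y-spec , φ) ∷ _) (here (child a)) =
      TiedName-mono (λ r∈Y → proj₁ (to (Y-spec _) r∈Y))
                    (λ i∈I → proj₁ (to (I-spec _) i∈I))
                    (PhiRel-above⇒tied φ a)
    entries-above⇒tied (_ ∷ specs) (there a) = entries-above⇒tied specs a

lemma6 : (T : BaseForest) (X : List (Res T)) (As : List (SeqNF T)) →
    WellFormedNF T (nf X As) → Compatible T (nfProc T (nf X As)) →
    (F : List (Tree T (Fin (length As)))) →
    PhiRel T (comp T As) X (allFin (length As)) F →
    ∀ {tr} → tr ∈ F →
    (xs : List (Name × BaseTy T)) (j : Fin (length As)) →
    PathIn T tr (map (resL T) xs ++ [ leaf j ]) →
    ∀ {x t} → (x , t) ∈ xs →
    TiedName T (comp T As) X (allFin (length As)) x j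
lemma6 T X As _ _ F φ tr∈F xs j path xt∈xs =
  PhiRel-above⇒tied T (comp T As) φ
    (lose tr∈F (pathIn⇒above path (∈-map⁺ (resL T) xt∈xs)))
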